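{- Let $t>3$ be an odd integer and $m$ a positive integer. Then: (a) if $t\equiv 1$ or $9\pmod{10}$ and $n=5m\ge 4t$, then $\chi_2(C_n(2,t))=5$; (b) if $t\in\{5,7,13\}$ and $n=6m\ge 4t$, then $\chi_2(C_n(2,t))=6$; (c) if $t\equiv 3,5$ or $7\pmod{10}$, $t\ge 15$, and $n=sm\ge 4t$, where $a$ and $\ell<5$ are the nonnegative integers with $t+1=5a+\ell$, $k=a-\ell$, and $s=5k+6\ell$, then $\chi_2(C_n(2,t))=6$. Furthermore, $\chi_2(C_n(2,3))=7$ whenever $n=7m$ with $m$ a positive integer.
   Context: For integers $n$ and $s_1,\ldots,s_k$, the circulant graph $C_n(s_1,\ldots,s_k)$ has vertex set $\{0,1,\ldots,n-1\}$, and each vertex $i$ is adjacent to $i+s_j \pmod n$ (and hence to $i-s_j\pmod n$) for every $j$. For a graph $G$, a $2$-distance $k$-coloring is a map $f:V(G)\to\{1,\ldots,k\}$ such that any two distinct vertices $u,v$ with $f(u)=f(v)$ satisfy $d_G(u,v)>2$ ($d_G$ the shortest-path distance); $\chi_2(G)$ is the smallest such $k$. -}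

module Defs where

open import Data.Nat using (ℕ; _+_; _*_; _<_)
open import Data.Fin using (Fin; toℕ)
open import Data.List using (List)
open import Data.List.Membership.Propositional using (_∈_)
open import Data.Product using (Σ; ∃; _×_)
open import Data.Sum using (_⊎_)
open import Relation.Binary.PropositionalEquality using (_≡_; _≢_)
open import Relation.Nullary using (¬_)

infix 4 _≡_[mod_]
_≡_[mod_] : ℕ → ℕ → ℕ → Set
a ≡ b [mod n ] = ∃ λ q → (a ≡ b + q * n) ⊎ (b ≡ a + q * n)

CircAdj : (n : ℕ) → List ℕ → Fin n → Fin n → Set
CircAdj n S i j = ∃ λ s → (s ∈ S) × (((toℕ i + s) ≡ toℕ j [mod n ]) ⊎ ((toℕ j + s) ≡ toℕ i [mod n ]))

-- for distinct u, v : d(u,v) ≤ 2 iff adjacent or with a common neighbour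
Dist≤2 : (n : ℕ) → List ℕ → Fin n → Fin n → Set
Dist≤2 n S u v = CircAdj n S u v ⊎ (∃ λ w → CircAdj n S u w × CircAdj n S w v)

TwoDistColoring : (n : ℕ) → List ℕ → ℕ → Set
TwoDistColoring n S k =
  Σ (Fin n → Fin k) λ f → ∀ u v → u ≢ v → f u ≡ f v → ¬ Dist≤2 n S u v

χ₂≡ : (n : ℕ) → List ℕ → ℕ → Set
χ₂≡ n S k = TwoDistColoring n S k × (∀ j → j < k → ¬ TwoDistColoring n S j)

module Submission where

-- If p ∣ n, reducing vertices mod p maps walks of length ≤ 2 in C_n(2,t) to walks
-- in C_p(2,t), so a 2-distance colouring of C_p(2,t) lifts to C_n(2,t) as long as no
-- non-backtracking walk of length ≤ 2 closes up in C_p(2,t).  For p = 5, 6, 7 the colouring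
-- u ↦ u works.  For p = t + 1 = 5k + 6ℓ, where t ≡ -1, the colour sequence is k blocks 0…4
-- followed by ℓ blocks 0…5, so that any two vertices at cyclic distance 1…4 differ.
--
-- Composing a colouring with x ↦ x mod n gives a colouring g of ℤ in which x and
-- x + d differ for d = ±2, ±t, ±4, ±2t, ±(t + 2), ±(t − 2) (this needs 2t < n).  The ball
-- {v, v ± 2, v ± t} is then a 5-clique, and for t = 3 the set {0, …, 6} is a 7-clique.  With
-- exactly 5 colours every ball uses every colour; this forces g (4 + t) = g 0 or g (4 − t) = g 0,
-- such a relation propagates along the lattice spanned by 4 ± t and 2 ∓ 2t, and for
-- t ≡ 0, 2, 3 (mod 5) that lattice contains one of the forbidden differences ±2, t, 2t.

open import Defs
open import Data.Nat as ℕ using (ℕ; _+_; _*_; _∸_; _<_; _≤_; _%_; NonZero; z≤n; s≤s)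
import Data.Nat.Properties as ℕ
import Data.Nat.DivMod as ℕ
import Data.Nat.Divisibility as ℕ
open import Data.Nat.Tactic.RingSolver using () renaming (solve-∀ to solve-∀ᴺ)
open import Data.Integer as ℤ using (ℤ; +_; -[1+_]; ∣_∣)
import Data.Integer.Properties as ℤ
import Data.Integer.DivMod as ℤ
open import Data.Integer.Divisibility.Signed
  using (_∣_; divides; _∣?_; ∣ᵤ⇒∣; ∣⇒∣ᵤ; ∣m⇒∣-m; ∣m∣n⇒∣m+n; ∣-trans)
open import Data.Integer.Tactic.RingSolver using (solve-∀)
open import Data.Fin as Fin using (Fin; zero; suc; toℕ; fromℕ<)
import Data.Fin.Properties as Fin
open import Data.List using (List; _∷_; [])
open import Data.List.Membership.Propositional using (_∈_)
open import Data.List.Relation.Unary.Any using (here; there)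
open import Data.Product using (∃; _×_; _,_; proj₁; proj₂)
open import Data.Sum as Sum using (_⊎_; inj₁; inj₂; [_,_]′)
open import Data.Empty using (⊥; ⊥-elim)
open import Function using (_∘_)
open import Relation.Nullary using (¬_; yes; no; Dec; _×-dec_; _⊎-dec_; _→-dec_)
import Relation.Nullary.Decidable as Dec
open import Relation.Nullary.Decidable using (from-yes)
open import Relation.Binary.PropositionalEquality
  using (_≡_; _≢_; refl; sym; trans; cong; cong₂; subst; subst₂; module ≡-Reasoning)
open ≡-Reasoning

-- Congruences of integers

-- A record rather than a synonym, so that x and y can be inferred.
infix 4 _≡ᶻ_[mod_]
record _≡ᶻ_[mod_] (x y : ℤ) (n : ℕ) : Set where
  constructor mod∣
  field ∣difference : + n ∣ y ℤ.- x
open _≡ᶻ_[mod_]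

module _ {n : ℕ} where

  ≡ᶻ-refl : ∀ {x} → x ≡ᶻ x [mod n ]
  ≡ᶻ-refl {x} = mod∣ (divides (+ 0) (ℤ.+-inverseʳ x))

  ≡ᶻ-reflexive : ∀ {x y} → x ≡ y → x ≡ᶻ y [mod n ]
  ≡ᶻ-reflexive refl = ≡ᶻ-refl

  ≡ᶻ-sym : ∀ {x y} → x ≡ᶻ y [mod n ] → y ≡ᶻ x [mod n ]
  ≡ᶻ-sym {x} {y} (mod∣ n∣y-x) = mod∣ (subst (+ n ∣_) (negate x y) (∣m⇒∣-m n∣y-x))
    where
    negate : ∀ x y → ℤ.- (y ℤ.- x) ≡ x ℤ.- y
    negate = solve-∀

  ≡ᶻ-trans : ∀ {x y z} → x ≡ᶻ y [mod n ] → y ≡ᶻ z [mod n ] → x ≡ᶻ z [mod n ]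
  ≡ᶻ-trans {x} {y} {z} (mod∣ n∣y-x) (mod∣ n∣z-y) =
    mod∣ (subst (+ n ∣_) (telescope x y z) (∣m∣n⇒∣m+n n∣z-y n∣y-x))
    where
    telescope : ∀ x y z → (z ℤ.- y) ℤ.+ (y ℤ.- x) ≡ z ℤ.- x
    telescope = solve-∀

  ≡ᶻ-+ : ∀ {x y x′ y′} → x ≡ᶻ y [mod n ] → x′ ≡ᶻ y′ [mod n ] →
         x ℤ.+ x′ ≡ᶻ y ℤ.+ y′ [mod n ]
  ≡ᶻ-+ {x} {y} {x′} {y′} (mod∣ n∣y-x) (mod∣ n∣y′-x′) =
    mod∣ (subst (+ n ∣_) (regroup x y x′ y′) (∣m∣n⇒∣m+n n∣y-x n∣y′-x′))
    where
    regroup : ∀ x y x′ y′ → (y ℤ.- x) ℤ.+ (y′ ℤ.- x′) ≡ (y ℤ.+ y′) ℤ.- (x ℤ.+ x′)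
    regroup = solve-∀

  ≡ᶻ-neg : ∀ {x y} → x ≡ᶻ y [mod n ] → ℤ.- x ≡ᶻ ℤ.- y [mod n ]
  ≡ᶻ-neg {x} {y} (mod∣ n∣y-x) = mod∣ (subst (+ n ∣_) (negate x y) (∣m⇒∣-m n∣y-x))
    where
    negate : ∀ x y → ℤ.- (y ℤ.- x) ≡ ℤ.- y ℤ.- ℤ.- x
    negate = solve-∀

  ≡ᶻ-move : ∀ {x y s} → x ℤ.+ s ≡ᶻ y [mod n ] → x ≡ᶻ y ℤ.- s [mod n ]
  ≡ᶻ-move {x} {y} {s} x+s≡y =
    subst (λ z → z ≡ᶻ y ℤ.- s [mod n ]) (cancel x s) (≡ᶻ-+ x+s≡y (≡ᶻ-refl {x = ℤ.- s}))
    where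
    cancel : ∀ x s → x ℤ.+ s ℤ.- s ≡ x
    cancel = solve-∀

  ≡ᶻ-unmove : ∀ {x y s} → x ≡ᶻ y ℤ.- s [mod n ] → x ℤ.+ s ≡ᶻ y [mod n ]
  ≡ᶻ-unmove {x} {y} {s} x≡y-s =
    subst (λ z → x ℤ.+ s ≡ᶻ z [mod n ]) (cancel y s) (≡ᶻ-+ x≡y-s (≡ᶻ-refl {x = s}))
    where
    cancel : ∀ y s → y ℤ.- s ℤ.+ s ≡ y
    cancel = solve-∀

  ≡ᶻ-weaken : ∀ {p x y} → p ℕ.∣ n → x ≡ᶻ y [mod n ] → x ≡ᶻ y [mod p ]
  ≡ᶻ-weaken p∣n (mod∣ n∣y-x) = mod∣ (∣-trans (∣ᵤ⇒∣ p∣n) n∣y-x)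

  ∣-resp-≡ᶻ : ∀ {x y} → x ≡ᶻ y [mod n ] → + n ∣ x → + n ∣ y
  ∣-resp-≡ᶻ {x} {y} (mod∣ n∣y-x) n∣x = subst (+ n ∣_) (cancel x y) (∣m∣n⇒∣m+n n∣x n∣y-x)
    where
    cancel : ∀ x y → x ℤ.+ (y ℤ.- x) ≡ y
    cancel = solve-∀

  ∣-shift : ∀ {x d} → x ≡ᶻ x ℤ.+ d [mod n ] → + n ∣ d
  ∣-shift {x} {d} (mod∣ n∣d) = subst (+ n ∣_) (cancel x d) n∣d
    where
    cancel : ∀ x d → x ℤ.+ d ℤ.- x ≡ d
    cancel = solve-∀

  divisible-small : ∀ {d} → + n ∣ d → ∣ d ∣ < n → d ≡ + 0
  divisible-small {d} n∣d ∣d∣<n with ∣ d ∣ ℕ.≟ 0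
  ... | yes ∣d∣≡0 = ℤ.∣i∣≡0⇒i≡0 ∣d∣≡0
  ... | no ∣d∣≢0 = ⊥-elim (ℕ.<⇒≱ ∣d∣<n (ℕ.∣⇒≤ {{ℕ.≢-nonZero ∣d∣≢0}} (∣⇒∣ᵤ n∣d)))

  ≡ᶻ-%ℕ : .{{_ : NonZero n}} → ∀ x → + (x ℤ.%ℕ n) ≡ᶻ x [mod n ]
  ≡ᶻ-%ℕ x = mod∣ (divides (x ℤ./ℕ n) (trans (cong (ℤ._- r) (ℤ.a≡a%ℕn+[a/ℕn]*n x n)) (cancel r _)))
    where
    r = + (x ℤ.%ℕ n)
    cancel : ∀ r m → (r ℤ.+ m) ℤ.- r ≡ m
    cancel = solve-∀

  ≡ᶻ-+multiple : ∀ {a} q → + a ≡ᶻ + (a + q * n) [mod n ]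
  ≡ᶻ-+multiple {a} q = mod∣ (divides (+ q) (begin
    + (a + q * n) ℤ.- + a        ≡⟨ cong (λ m → ℤ._+_ (+ a) m ℤ.- + a) (ℤ.pos-* q n) ⟩
    + a ℤ.+ + q ℤ.* + n ℤ.- + a  ≡⟨ cancel (+ a) (+ q ℤ.* + n) ⟩
    + q ℤ.* + n                  ∎))
    where
    cancel : ∀ r m → (r ℤ.+ m) ℤ.- r ≡ m
    cancel = solve-∀

  [mod]⇒≡ᶻ : ∀ {a b} → a ≡ b [mod n ] → + a ≡ᶻ + b [mod n ]
  [mod]⇒≡ᶻ (q , inj₁ refl) = ≡ᶻ-sym (≡ᶻ-+multiple q)
  [mod]⇒≡ᶻ (q , inj₂ refl) = ≡ᶻ-+multiple q

  ≡ᶻ⇒[mod] : ∀ {a b} → + a ≡ᶻ + b [mod n ] → a ≡ b [mod n ]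
  ≡ᶻ⇒[mod] {a} {b} (mod∣ (divides (+ q) eq)) =
    q , inj₂ (ℤ.+-injective (begin
      + b                    ≡⟨ difference (+ a) (+ b) ⟩
      + a ℤ.+ (+ b ℤ.- + a)  ≡⟨ cong (ℤ._+_ (+ a)) eq ⟩
      + a ℤ.+ + q ℤ.* + n    ≡⟨ cong (ℤ._+_ (+ a)) (ℤ.pos-* q n) ⟨
      + (a + q * n)          ∎))
    where
    difference : ∀ x y → y ≡ x ℤ.+ (y ℤ.- x)
    difference = solve-∀
  ≡ᶻ⇒[mod] {a} {b} (mod∣ (divides -[1+ q ] eq)) =
    ℕ.suc q , inj₁ (ℤ.+-injective (begin
      + a                              ≡⟨ difference (+ a) (+ b) ⟩
      + b ℤ.- (+ b ℤ.- + a)            ≡⟨ cong (ℤ._-_ (+ b)) eq ⟩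
      + b ℤ.- ℤ.- (+ ℕ.suc q) ℤ.* + n  ≡⟨ negate (+ b) (+ ℕ.suc q) (+ n) ⟩
      + b ℤ.+ + ℕ.suc q ℤ.* + n        ≡⟨ cong (ℤ._+_ (+ b)) (ℤ.pos-* (ℕ.suc q) n) ⟨
      + (b + ℕ.suc q * n)              ∎))
    where
    difference : ∀ x y → x ≡ y ℤ.- (y ℤ.- x)
    difference = solve-∀
    negate : ∀ y k m → y ℤ.- ℤ.- k ℤ.* m ≡ y ℤ.+ k ℤ.* m
    negate = solve-∀

  ≡ᶻ⇒[mod]-signed : ∀ {a b} d → + b ≡ᶻ + a ℤ.+ d [mod n ] →
                    a + ∣ d ∣ ≡ b [mod n ] ⊎ b + ∣ d ∣ ≡ a [mod n ]
  ≡ᶻ⇒[mod]-signed (+ c) b≡a+c = inj₁ (≡ᶻ⇒[mod] (≡ᶻ-sym b≡a+c))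
  ≡ᶻ⇒[mod]-signed -[1+ c ] b≡a-c = inj₂ (≡ᶻ⇒[mod] (≡ᶻ-unmove {s = + ℕ.suc c} b≡a-c))

  [mod]-unique : .{{_ : NonZero n}} → ∀ {a b} → a < n → b < n → a ≡ b [mod n ] → a ≡ b
  [mod]-unique a<n b<n (q , a≡b+qn⊎b≡a+qn) =
    [ reduce {q = q} a<n b<n , (λ b≡a+qn → sym (reduce {q = q} b<n a<n b≡a+qn)) ]′ a≡b+qn⊎b≡a+qn
    where
    reduce : ∀ {a b q} → a < n → b < n → a ≡ b + q * n → a ≡ b
    reduce {a} {b} {q} a<n b<n refl = begin
      b + q * n        ≡⟨ ℕ.m<n⇒m%n≡m a<n ⟨
      (b + q * n) % n  ≡⟨ ℕ.[m+kn]%n≡m%n b q n ⟩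
      b % n            ≡⟨ ℕ.m<n⇒m%n≡m b<n ⟩
      b                ∎

  ≡ᶻ-unique : .{{_ : NonZero n}} → ∀ {a b} → a < n → b < n → + a ≡ᶻ + b [mod n ] → a ≡ b
  ≡ᶻ-unique a<n b<n = [mod]-unique a<n b<n ∘ ≡ᶻ⇒[mod]

-- Colourings of ℤ that separate short differences

module Separation {K : ℕ} (g : ℤ → Fin K) where

  clique-bound : ∀ {k} (P : Fin k → ℤ) → (∀ {i j} → i Fin.< j → g (P i) ≢ g (P j)) → k ≤ K
  clique-bound P rainbow = ℕ.≮⇒≥ λ K<k →
    let i , j , i<j , same = Fin.pigeonhole K<k (λ i → g (P i)) in rainbow i<j same

  clique-complete : (P : Fin K → ℤ) → (∀ {i j} → i Fin.< j → g (P i) ≢ g (P j)) →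
                    ∀ c → ∃ λ i → g (P i) ≡ c
  clique-complete P rainbow c with Fin.any? (λ i → g (P i) Fin.≟ c)
  ... | yes hit = hit
  ... | no miss = no-repetition (Fin.pigeonhole ℕ.≤-refl colour)
    where
    colour : Fin (ℕ.suc K) → Fin K
    colour zero = c
    colour (suc i) = g (P i)
    no-repetition : (∃ λ i → ∃ λ j → i Fin.< j × colour i ≡ colour j) → ∃ λ i → g (P i) ≡ c
    no-repetition (zero , suc j , _ , c≡) = ⊥-elim (miss (j , sym c≡))
    no-repetition (suc i , suc j , s≤s i<j , same) = ⊥-elim (rainbow i<j same)

  Separates : ℤ → Set
  Separates d = ∀ x → g x ≢ g (x ℤ.+ d)

  separated : ∀ {d x y} → Separates d → y ≡ x ℤ.+ d → g x ≢ g y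
  separated sep refl = sep _

  separated′ : ∀ {d x y} → Separates d → x ≡ y ℤ.+ d → g x ≢ g y
  separated′ sep x≡y+d same = separated sep x≡y+d (sym same)

  separates-resp : ∀ {d e} → d ≡ e → Separates d → Separates e
  separates-resp refl sep = sep

  separates-neg : ∀ {d} → Separates d → Separates (ℤ.- d)
  separates-neg {d} sep x same = separated sep (cancel x d) (sym same)
    where
    cancel : ∀ x d → x ≡ (x ℤ.- d) ℤ.+ d
    cancel = solve-∀

  record Distance2 (a b : ℤ) : Set where
    field
      sep-a   : Separates a
      sep-b   : Separates b
      sep-2a  : Separates (a ℤ.+ a)
      sep-2b  : Separates (b ℤ.+ b)
      sep-a+b : Separates (a ℤ.+ b)
      sep-a-b : Separates (a ℤ.- b)
  open Distance2 public

  swap : ∀ {a b} → Distance2 a b → Distance2 b a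
  swap {a} {b} D = record
    { sep-a = sep-b D ; sep-b = sep-a D ; sep-2a = sep-2b D ; sep-2b = sep-2a D
    ; sep-a+b = separates-resp (ℤ.+-comm a b) (sep-a+b D)
    ; sep-a-b = separates-resp (flip a b) (separates-neg (sep-a-b D)) }
    where
    flip : ∀ a b → ℤ.- (a ℤ.- b) ≡ b ℤ.- a
    flip = solve-∀

  rotate : ∀ {a b} → Distance2 a b → Distance2 (ℤ.- b) a
  rotate {a} {b} D = record
    { sep-a = separates-neg (sep-b D) ; sep-b = sep-a D
    ; sep-2a = separates-resp (ℤ.neg-distrib-+ b b) (separates-neg (sep-2b D)) ; sep-2b = sep-2a D
    ; sep-a+b = separates-resp (rot₁ a b) (sep-a-b D)
    ; sep-a-b = separates-resp (rot₂ a b) (separates-neg (sep-a+b D)) }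
    where
    rot₁ : ∀ a b → a ℤ.- b ≡ ℤ.- b ℤ.+ a
    rot₁ = solve-∀
    rot₂ : ∀ a b → ℤ.- (a ℤ.+ b) ≡ ℤ.- b ℤ.- a
    rot₂ = solve-∀

  reflect : ∀ {a b} → Distance2 a b → Distance2 a (ℤ.- b)
  reflect {a} {b} D = record
    { sep-a = sep-a D ; sep-b = separates-neg (sep-b D)
    ; sep-2a = sep-2a D ; sep-2b = separates-resp (ℤ.neg-distrib-+ b b) (separates-neg (sep-2b D))
    ; sep-a+b = sep-a-b D
    ; sep-a-b = separates-resp (cong (ℤ._+_ a) (sym (ℤ.neg-involutive b))) (sep-a+b D) }

  private
    shift₁ : ∀ v a → v ℤ.+ a ≡ (v ℤ.- a) ℤ.+ (a ℤ.+ a)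
    shift₁ = solve-∀
    shift₂ : ∀ v a b → v ℤ.+ a ≡ (v ℤ.+ b) ℤ.+ (a ℤ.- b)
    shift₂ = solve-∀
    shift₃ : ∀ v a b → v ℤ.+ a ≡ (v ℤ.- b) ℤ.+ (a ℤ.+ b)
    shift₃ = solve-∀
    shift₄ : ∀ v a b → v ℤ.+ b ≡ (v ℤ.- a) ℤ.+ (a ℤ.+ b)
    shift₄ = solve-∀
    shift₅ : ∀ v a b → v ℤ.- b ≡ (v ℤ.- a) ℤ.+ (a ℤ.- b)
    shift₅ = solve-∀

  ball : ℤ → ℤ → ℤ → Fin 5 → ℤ
  ball a b v zero = v
  ball a b v (suc zero) = v ℤ.+ a
  ball a b v (suc (suc zero)) = v ℤ.- a
  ball a b v (suc (suc (suc zero))) = v ℤ.+ b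
  ball a b v (suc (suc (suc (suc zero)))) = v ℤ.- b

  ball-rainbow : ∀ {a b} → Distance2 a b → ∀ v {i j} → i Fin.< j → g (ball a b v i) ≢ g (ball a b v j)
  ball-rainbow D v {zero} {suc zero} _ = sep-a D v
  ball-rainbow D v {zero} {suc (suc zero)} _ = separates-neg (sep-a D) v
  ball-rainbow D v {zero} {suc (suc (suc zero))} _ = sep-b D v
  ball-rainbow D v {zero} {suc (suc (suc (suc zero)))} _ = separates-neg (sep-b D) v
  ball-rainbow D v {_} {zero} ()
  ball-rainbow D v {suc _} {suc zero} (s≤s ())
  ball-rainbow {a} D v {suc zero} {suc (suc zero)} _ = separated′ (sep-2a D) (shift₁ v a)
  ball-rainbow {a} {b} D v {suc zero} {suc (suc (suc zero))} _ = separated′ (sep-a-b D) (shift₂ v a b)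
  ball-rainbow {a} {b} D v {suc zero} {suc (suc (suc (suc zero)))} _ = separated′ (sep-a+b D) (shift₃ v a b)
  ball-rainbow D v {suc (suc _)} {suc (suc zero)} (s≤s (s≤s ()))
  ball-rainbow {a} {b} D v {suc (suc zero)} {suc (suc (suc zero))} _ = separated (sep-a+b D) (shift₄ v a b)
  ball-rainbow {a} {b} D v {suc (suc zero)} {suc (suc (suc (suc zero)))} _ = separated (sep-a-b D) (shift₅ v a b)
  ball-rainbow D v {suc (suc (suc _))} {suc (suc (suc zero))} (s≤s (s≤s (s≤s ())))
  ball-rainbow {b = b} D v {suc (suc (suc zero))} {suc (suc (suc (suc zero)))} _ = separated′ (sep-2b D) (shift₁ v b)
  ball-rainbow D v {suc (suc (suc (suc _)))} {suc (suc (suc (suc zero)))} (s≤s (s≤s (s≤s (s≤s ()))))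

  five≤colours : ∀ {a b} → Distance2 a b → 5 ≤ K
  five≤colours D = clique-bound (ball _ _ (+ 0)) (ball-rainbow D (+ 0))

  interval-bound : ∀ k → (∀ d → 0 < d → d < k → Separates (+ d)) → k ≤ K
  interval-bound k sep = clique-bound (λ i → + toℕ i) λ {i} {j} i<j →
    separated (sep (toℕ j ∸ toℕ i) (ℕ.m<n⇒0<n∸m i<j) (ℕ.≤-<-trans (ℕ.m∸n≤m (toℕ j) (toℕ i)) (Fin.toℕ<n j)))
              (cong +_ (sym (ℕ.m+[n∸m]≡n (ℕ.<⇒≤ i<j))))

  seven≤colours : Distance2 (+ 2) (+ 3) → 7 ≤ K
  seven≤colours D = interval-bound 7 separates-1…6
    where
    separates-1…6 : ∀ d → 0 < d → d < 7 → Separates (+ d)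
    separates-1…6 1 _ _ = separates-neg (sep-a-b D)
    separates-1…6 2 _ _ = sep-a D
    separates-1…6 3 _ _ = sep-b D
    separates-1…6 4 _ _ = sep-2a D
    separates-1…6 5 _ _ = sep-a+b D
    separates-1…6 6 _ _ = sep-2b D
    separates-1…6 (ℕ.suc (ℕ.suc (ℕ.suc (ℕ.suc (ℕ.suc (ℕ.suc (ℕ.suc _))))))) _
                  (s≤s (s≤s (s≤s (s≤s (s≤s (s≤s (s≤s ())))))))

module FiveColours (g : ℤ → Fin 5) where
  open Separation g

  ball-complete : ∀ {a b} → Distance2 a b → ∀ v c → ∃ λ i → g (ball a b v i) ≡ c
  ball-complete D v = clique-complete (ball _ _ v) (ball-rainbow D v)

  Repeats : ℤ → ℤ → ℤ → Set
  Repeats a b p = g (p ℤ.+ (a ℤ.+ a ℤ.+ b)) ≡ g p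

  repeats-resp : ∀ {a b a′ b′ p} → a ≡ a′ → b ≡ b′ → Repeats a b p → Repeats a′ b′ p
  repeats-resp refl refl r = r

  repeats-either : ∀ {a b} → Distance2 a b → ∀ q → Repeats a b q ⊎ Repeats b a q
  repeats-either {a} {b} D q = decide (ball-complete D (q ℤ.+ a ℤ.+ b) (g q))
    where
    e₀ : ∀ q a b → q ℤ.+ a ℤ.+ b ≡ q ℤ.+ (a ℤ.+ b)
    e₀ = solve-∀
    e₁ : ∀ q a b → q ℤ.+ (a ℤ.+ a ℤ.+ b) ≡ q ℤ.+ a ℤ.+ b ℤ.+ a
    e₁ = solve-∀
    e₂ : ∀ q a b → q ℤ.+ a ℤ.+ b ℤ.- a ≡ q ℤ.+ b
    e₂ = solve-∀
    e₃ : ∀ q a b → q ℤ.+ (b ℤ.+ b ℤ.+ a) ≡ q ℤ.+ a ℤ.+ b ℤ.+ b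
    e₃ = solve-∀
    e₄ : ∀ q a b → q ℤ.+ a ℤ.+ b ℤ.- b ≡ q ℤ.+ a
    e₄ = solve-∀
    decide : (∃ λ i → g (ball a b (q ℤ.+ a ℤ.+ b) i) ≡ g q) → Repeats a b q ⊎ Repeats b a q
    decide (zero , same) = ⊥-elim (separated (sep-a+b D) (e₀ q a b) (sym same))
    decide (suc zero , same) = inj₁ (trans (cong g (e₁ q a b)) same)
    decide (suc (suc zero) , same) = ⊥-elim (separated (sep-b D) (e₂ q a b) (sym same))
    decide (suc (suc (suc zero)) , same) = inj₂ (trans (cong g (e₃ q a b)) same)
    decide (suc (suc (suc (suc zero))) , same) = ⊥-elim (separated (sep-a D) (e₄ q a b) (sym same))

  repeats-rotate : ∀ {a b p} → Distance2 a b → Repeats a b p → Repeats (ℤ.- b) a p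
  repeats-rotate {a} {b} {p} D r = decide (ball-complete D (p ℤ.+ a ℤ.- b) (g p))
    where
    e₀ : ∀ p a b → p ℤ.+ a ℤ.- b ≡ p ℤ.+ (a ℤ.- b)
    e₀ = solve-∀
    e₁ : ∀ p a b → p ℤ.+ (a ℤ.+ a ℤ.+ b) ≡ (p ℤ.+ a ℤ.- b ℤ.+ a) ℤ.+ (b ℤ.+ b)
    e₁ = solve-∀
    e₂ : ∀ p a b → p ≡ (p ℤ.+ a ℤ.- b ℤ.- a) ℤ.+ b
    e₂ = solve-∀
    e₃ : ∀ p a b → p ℤ.+ a ℤ.- b ℤ.+ b ≡ p ℤ.+ a
    e₃ = solve-∀
    e₄ : ∀ p a b → p ℤ.+ (ℤ.- b ℤ.+ ℤ.- b ℤ.+ a) ≡ p ℤ.+ a ℤ.- b ℤ.- b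
    e₄ = solve-∀
    decide : (∃ λ i → g (ball a b (p ℤ.+ a ℤ.- b) i) ≡ g p) → Repeats (ℤ.- b) a p
    decide (zero , same) = ⊥-elim (separated (sep-a-b D) (e₀ p a b) (sym same))
    decide (suc zero , same) = ⊥-elim (separated (sep-2b D) (e₁ p a b) (trans same (sym r)))
    decide (suc (suc zero) , same) = ⊥-elim (separated′ (sep-b D) (e₂ p a b) (sym same))
    decide (suc (suc (suc zero)) , same) = ⊥-elim (separated (sep-a D) (e₃ p a b) (sym same))
    decide (suc (suc (suc (suc zero))) , same) = trans (cong g (e₄ p a b)) same

  repeats-unrotate : ∀ {a b p} → Distance2 a b → Repeats (ℤ.- b) a p → Repeats a b p
  repeats-unrotate {a} {b} D r =
    repeats-resp (ℤ.neg-involutive a) (ℤ.neg-involutive b)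
      (repeats-rotate (rotate (rotate (rotate D))) (repeats-rotate (rotate (rotate D)) (repeats-rotate (rotate D) r)))

  repeats-shift : ∀ {a b p} → Distance2 a b → Repeats a b p → Repeats a b (p ℤ.+ (a ℤ.+ a ℤ.+ b))
  repeats-shift {a} {b} {p} D r with repeats-either D (p ℤ.+ (a ℤ.+ a ℤ.+ b))
  ... | inj₁ r′ = r′
  ... | inj₂ r′ = ⊥-elim (separated (sep-a-b D) refl
                    (trans (sym r) (trans (sym r″) (cong g (back p a b)))))
    where
    r″ = repeats-rotate (rotate (swap D)) (repeats-rotate (swap D) r′)
    back : ∀ p a b → (p ℤ.+ (a ℤ.+ a ℤ.+ b)) ℤ.+ (ℤ.- b ℤ.+ ℤ.- b ℤ.+ ℤ.- a) ≡ p ℤ.+ (a ℤ.- b)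
    back = solve-∀

  Transports : ℤ → ℤ → ℤ → Set
  Transports a b s = ∀ p → Repeats a b p → Repeats a b (p ℤ.+ s) × g (p ℤ.+ s) ≡ g p

  transports-resp : ∀ {a b s s′} → s ≡ s′ → Transports a b s → Transports a b s′
  transports-resp refl t = t

  transports-2a+b : ∀ {a b} → Distance2 a b → Transports a b (a ℤ.+ a ℤ.+ b)
  transports-2a+b D p r = repeats-shift D r , r

  transports-a-2b : ∀ {a b} → Distance2 a b → Transports a b (a ℤ.- b ℤ.- b)
  transports-a-2b {a} {b} D p r =
    subst (Repeats a b) (reorder p a b) (repeats-unrotate D (repeats-shift (rotate D) r′)) ,
    trans (cong g (sym (reorder p a b))) r′
    where
    r′ = repeats-rotate D r
    reorder : ∀ p a b → p ℤ.+ (ℤ.- b ℤ.+ ℤ.- b ℤ.+ a) ≡ p ℤ.+ (a ℤ.- b ℤ.- b)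
    reorder = solve-∀

  transports-+ : ∀ {a b s s′} → Transports a b s → Transports a b s′ → Transports a b (s ℤ.+ s′)
  transports-+ {a} {b} {s} {s′} t t′ p r =
    let r₁ , same₁ = t p r ; r₂ , same₂ = t′ (p ℤ.+ s) r₁ in
    subst (λ q → Repeats a b q × g q ≡ g p) (ℤ.+-assoc p s s′) (r₂ , trans same₂ same₁)

  transports-* : ∀ {a b s} → Transports a b s → ∀ k → Transports a b (+ k ℤ.* s)
  transports-* {a} {b} t ℕ.zero p r = subst (λ q → Repeats a b q × g q ≡ g p) (sym (ℤ.+-identityʳ p)) (r , refl)
  transports-* {a} {b} {s} t (ℕ.suc k) =
    transports-resp {a} {b} (unfold (+ k) s) (transports-+ {a} {b} t (transports-* {a} {b} t k))
    where
    unfold : ∀ k s → s ℤ.+ k ℤ.* s ≡ (+ 1 ℤ.+ k) ℤ.* s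
    unfold = solve-∀

  repeats-lattice : ∀ {a b p} → Distance2 a b → Repeats a b p → ∀ α β →
                    g (p ℤ.+ (+ α ℤ.* (a ℤ.+ a ℤ.+ b) ℤ.+ + β ℤ.* (a ℤ.- b ℤ.- b))) ≡ g p
  repeats-lattice {a} {b} D r α β =
    proj₂ (transports-+ {a} {b} (transports-* {a} {b} (transports-2a+b D) α)
                                (transports-* {a} {b} (transports-a-2b D) β) _ r)

  InLattice : ℤ → ℤ → ℤ → Set
  InLattice a b d = ∃ λ α → ∃ λ β → + α ℤ.* (a ℤ.+ a ℤ.+ b) ℤ.+ + β ℤ.* (a ℤ.- b ℤ.- b) ≡ d

  lattice-obstruction : ∀ {a b d d′} → Distance2 a b → Separates d → InLattice a b d →
                        Separates d′ → InLattice a (ℤ.- b) d′ → ⊥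
  lattice-obstruction {a} {b} D sep (α , β , eq) sep′ (α′ , β′ , eq′) with repeats-either D (+ 0)
  ... | inj₁ rep = separated sep (cong (ℤ._+_ (+ 0)) eq) (sym (repeats-lattice D rep α β))
  ... | inj₂ rep = separated sep′ (cong (ℤ._+_ (+ 0)) eq′) (sym (repeats-lattice (reflect D) rep′ α′ β′))
    where
    rep′ : Repeats a (ℤ.- b) (+ 0)
    rep′ = repeats-unrotate (reflect D) (repeats-resp {b′ = a} (sym (ℤ.neg-involutive b)) refl rep)

  no-distance2-colouring : ∀ t → t % 5 ≡ 0 ⊎ t % 5 ≡ 2 ⊎ t % 5 ≡ 3 → ¬ Distance2 (+ 2) (+ t)
  no-distance2-colouring t t%5∈ D = refute t%5∈ (subst (Distance2 (+ 2)) division D)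
    where
    q = t ℕ./ 5
    division : + t ≡ + 5 ℤ.* + q ℤ.+ + (t % 5)
    division = begin
      + t                          ≡⟨ ℤ.a≡a%ℕn+[a/ℕn]*n (+ t) 5 ⟩
      + (t % 5) ℤ.+ + q ℤ.* + 5    ≡⟨ ℤ.+-comm (+ (t % 5)) (+ q ℤ.* + 5) ⟩
      + q ℤ.* + 5 ℤ.+ + (t % 5)    ≡⟨ cong (λ m → m ℤ.+ + (t % 5)) (ℤ.*-comm (+ q) (+ 5)) ⟩
      + 5 ℤ.* + q ℤ.+ + (t % 5)    ∎
    -- Each pair (α , β) below puts a separated difference into the lattice for b = t, resp. b = −t.
    refute : ∀ {r} → r ≡ 0 ⊎ r ≡ 2 ⊎ r ≡ 3 → ¬ Distance2 (+ 2) (+ 5 ℤ.* + q ℤ.+ + r)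
    refute (inj₁ refl) D =
      lattice-obstruction D (sep-a D) (q + q , q + 1 , e₊ (+ q)) (sep-2b D) (q + q , q , e₋ (+ q))
      where
      e₊ : ∀ Q → (Q ℤ.+ Q) ℤ.* (+ 4 ℤ.+ (+ 5 ℤ.* Q ℤ.+ + 0))
                 ℤ.+ (Q ℤ.+ + 1) ℤ.* (+ 2 ℤ.- (+ 5 ℤ.* Q ℤ.+ + 0) ℤ.- (+ 5 ℤ.* Q ℤ.+ + 0)) ≡ + 2
      e₊ = solve-∀
      e₋ : ∀ Q → (Q ℤ.+ Q) ℤ.* (+ 4 ℤ.+ ℤ.- (+ 5 ℤ.* Q ℤ.+ + 0))
                 ℤ.+ Q ℤ.* (+ 2 ℤ.- ℤ.- (+ 5 ℤ.* Q ℤ.+ + 0) ℤ.- ℤ.- (+ 5 ℤ.* Q ℤ.+ + 0))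
                 ≡ (+ 5 ℤ.* Q ℤ.+ + 0) ℤ.+ (+ 5 ℤ.* Q ℤ.+ + 0)
      e₋ = solve-∀
    refute (inj₂ (inj₁ refl)) D =
      lattice-obstruction D (separates-neg (sep-a D)) (q + q , q + 1 , e₊ (+ q))
                            (sep-b D) (q + q + 1 , q , e₋ (+ q))
      where
      e₊ : ∀ Q → (Q ℤ.+ Q) ℤ.* (+ 4 ℤ.+ (+ 5 ℤ.* Q ℤ.+ + 2))
                 ℤ.+ (Q ℤ.+ + 1) ℤ.* (+ 2 ℤ.- (+ 5 ℤ.* Q ℤ.+ + 2) ℤ.- (+ 5 ℤ.* Q ℤ.+ + 2)) ≡ ℤ.- + 2
      e₊ = solve-∀
      e₋ : ∀ Q → (Q ℤ.+ Q ℤ.+ + 1) ℤ.* (+ 4 ℤ.+ ℤ.- (+ 5 ℤ.* Q ℤ.+ + 2))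
                 ℤ.+ Q ℤ.* (+ 2 ℤ.- ℤ.- (+ 5 ℤ.* Q ℤ.+ + 2) ℤ.- ℤ.- (+ 5 ℤ.* Q ℤ.+ + 2)) ≡ (+ 5 ℤ.* Q ℤ.+ + 2)
      e₋ = solve-∀
    refute (inj₂ (inj₂ refl)) D =
      lattice-obstruction D (sep-b D) (q + q + 1 , q + 1 , e₊ (+ q)) (sep-a D) (q + q + 2 , q , e₋ (+ q))
      where
      e₊ : ∀ Q → (Q ℤ.+ Q ℤ.+ + 1) ℤ.* (+ 4 ℤ.+ (+ 5 ℤ.* Q ℤ.+ + 3))
                 ℤ.+ (Q ℤ.+ + 1) ℤ.* (+ 2 ℤ.- (+ 5 ℤ.* Q ℤ.+ + 3) ℤ.- (+ 5 ℤ.* Q ℤ.+ + 3)) ≡ (+ 5 ℤ.* Q ℤ.+ + 3)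
      e₊ = solve-∀
      e₋ : ∀ Q → (Q ℤ.+ Q ℤ.+ + 2) ℤ.* (+ 4 ℤ.+ ℤ.- (+ 5 ℤ.* Q ℤ.+ + 3))
                 ℤ.+ Q ℤ.* (+ 2 ℤ.- ℤ.- (+ 5 ℤ.* Q ℤ.+ + 3) ℤ.- ℤ.- (+ 5 ℤ.* Q ℤ.+ + 3)) ≡ + 2
      e₋ = solve-∀

-- Walks of length at most two

data Step : Set where
  a⁺ a⁻ b⁺ b⁻ : Step

data Walk : Set where
  [_] : Step → Walk
  _∙_ : Step → Step → Walk

step : ℤ → ℤ → Step → ℤ
step a b a⁺ = a
step a b a⁻ = ℤ.- a
step a b b⁺ = b
step a b b⁻ = ℤ.- b

displacement : ℤ → ℤ → Walk → ℤ
displacement a b [ σ ] = step a b σ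
displacement a b (σ ∙ τ) = step a b σ ℤ.+ step a b τ

aSteps bSteps : Walk → ℤ
aSteps = displacement (+ 1) (+ 0)
bSteps = displacement (+ 0) (+ 1)

Backtracks : Walk → Set
Backtracks w = aSteps w ≡ + 0 × bSteps w ≡ + 0

backtracks? : ∀ w → Dec (Backtracks w)
backtracks? w = aSteps w ℤ.≟ + 0 ×-dec bSteps w ℤ.≟ + 0

displacement-linear : ∀ a b w → displacement a b w ≡ aSteps w ℤ.* a ℤ.+ bSteps w ℤ.* b
displacement-linear a b [ σ ] = step-linear σ
  where
  e₁ : ∀ a b → a ≡ + 1 ℤ.* a ℤ.+ + 0 ℤ.* b
  e₁ = solve-∀
  e₂ : ∀ a b → ℤ.- a ≡ -[1+ 0 ] ℤ.* a ℤ.+ + 0 ℤ.* b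
  e₂ = solve-∀
  e₃ : ∀ a b → b ≡ + 0 ℤ.* a ℤ.+ + 1 ℤ.* b
  e₃ = solve-∀
  e₄ : ∀ a b → ℤ.- b ≡ + 0 ℤ.* a ℤ.+ -[1+ 0 ] ℤ.* b
  e₄ = solve-∀
  step-linear : ∀ σ → displacement a b [ σ ] ≡ aSteps [ σ ] ℤ.* a ℤ.+ bSteps [ σ ] ℤ.* b
  step-linear a⁺ = e₁ a b
  step-linear a⁻ = e₂ a b
  step-linear b⁺ = e₃ a b
  step-linear b⁻ = e₄ a b
displacement-linear a b (σ ∙ τ) = begin
  step a b σ ℤ.+ step a b τ
    ≡⟨ cong₂ ℤ._+_ (displacement-linear a b [ σ ]) (displacement-linear a b [ τ ]) ⟩
  (aSteps [ σ ] ℤ.* a ℤ.+ bSteps [ σ ] ℤ.* b) ℤ.+ (aSteps [ τ ] ℤ.* a ℤ.+ bSteps [ τ ] ℤ.* b)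
    ≡⟨ regroup (aSteps [ σ ]) (bSteps [ σ ]) (aSteps [ τ ]) (bSteps [ τ ]) a b ⟩
  aSteps (σ ∙ τ) ℤ.* a ℤ.+ bSteps (σ ∙ τ) ℤ.* b ∎
  where
  regroup : ∀ α β α′ β′ a b →
            (α ℤ.* a ℤ.+ β ℤ.* b) ℤ.+ (α′ ℤ.* a ℤ.+ β′ ℤ.* b) ≡ (α ℤ.+ α′) ℤ.* a ℤ.+ (β ℤ.+ β′) ℤ.* b
  regroup = solve-∀

backtrack-displacement : ∀ a b {w} → Backtracks w → displacement a b w ≡ + 0
backtrack-displacement a b {w} (a-steps≡0 , b-steps≡0)
  rewrite displacement-linear a b w | a-steps≡0 | b-steps≡0 = refl

module _ {n : ℕ} {a b a′ b′ : ℤ} (a≡a′ : a ≡ᶻ a′ [mod n ]) (b≡b′ : b ≡ᶻ b′ [mod n ]) where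

  step-cong : ∀ σ → step a b σ ≡ᶻ step a′ b′ σ [mod n ]
  step-cong a⁺ = a≡a′
  step-cong a⁻ = ≡ᶻ-neg a≡a′
  step-cong b⁺ = b≡b′
  step-cong b⁻ = ≡ᶻ-neg b≡b′

  displacement-cong : ∀ w → displacement a b w ≡ᶻ displacement a′ b′ w [mod n ]
  displacement-cong [ σ ] = step-cong σ
  displacement-cong (σ ∙ τ) = ≡ᶻ-+ (step-cong σ) (step-cong τ)

allSteps? : {P : Step → Set} → (∀ σ → Dec (P σ)) → Dec (∀ σ → P σ)
allSteps? P? = Dec.map′ (λ (p , q , r , s) → λ { a⁺ → p ; a⁻ → q ; b⁺ → r ; b⁻ → s })
                        (λ all → all a⁺ , all a⁻ , all b⁺ , all b⁻)
                        (P? a⁺ ×-dec P? a⁻ ×-dec P? b⁺ ×-dec P? b⁻)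

allWalks? : {P : Walk → Set} → (∀ w → Dec (P w)) → Dec (∀ w → P w)
allWalks? P? = Dec.map′ (λ (p , q) → λ { [ σ ] → p σ ; (σ ∙ τ) → q σ τ })
                        (λ all → (λ σ → all [ σ ]) , (λ σ τ → all (σ ∙ τ)))
                        (allSteps? (λ σ → P? [ σ ]) ×-dec allSteps? (λ σ → allSteps? (λ τ → P? (σ ∙ τ))))

ShortCycleFree : ℕ → ℤ → ℤ → Set
ShortCycleFree p a b = ∀ w → + p ∣ displacement a b w → Backtracks w

shortCycleFree? : ∀ p a b → Dec (ShortCycleFree p a b)
shortCycleFree? p a b = allWalks? λ w → + p ∣? displacement a b w →-dec backtracks? w

shortCycleFree-cong : ∀ {p a b a′ b′} → a ≡ᶻ a′ [mod p ] → b ≡ᶻ b′ [mod p ] →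
                      ShortCycleFree p a′ b′ → ShortCycleFree p a b
shortCycleFree-cong a≡a′ b≡b′ free w closed =
  free w (∣-resp-≡ᶻ (displacement-cong a≡a′ b≡b′ w) closed)

-- Circulant graphs

module Circulant (n : ℕ) .{{_ : NonZero n}} (a b : ℕ) where

  S : List ℕ
  S = a ∷ b ∷ []

  ⟦_⟧ : ℤ → Fin n
  ⟦ x ⟧ = fromℕ< (ℤ.n%ℕd<d x n)

  ⟦⟧-≡ᶻ : ∀ x → + toℕ ⟦ x ⟧ ≡ᶻ x [mod n ]
  ⟦⟧-≡ᶻ x = subst (λ r → + r ≡ᶻ x [mod n ]) (sym (Fin.toℕ-fromℕ< (ℤ.n%ℕd<d x n))) (≡ᶻ-%ℕ x)

  ⟦⟧-cong : ∀ {x y} → x ≡ᶻ y [mod n ] → ⟦ x ⟧ ≡ ⟦ y ⟧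
  ⟦⟧-cong {x} {y} x≡y = Fin.toℕ-injective (≡ᶻ-unique (Fin.toℕ<n ⟦ x ⟧) (Fin.toℕ<n ⟦ y ⟧)
    (≡ᶻ-trans (⟦⟧-≡ᶻ x) (≡ᶻ-trans x≡y (≡ᶻ-sym (⟦⟧-≡ᶻ y)))))

  ⟦⟧-exact : ∀ {x y} → ⟦ x ⟧ ≡ ⟦ y ⟧ → x ≡ᶻ y [mod n ]
  ⟦⟧-exact {x} {y} same =
    ≡ᶻ-trans (≡ᶻ-sym (⟦⟧-≡ᶻ x)) (subst (λ u → + toℕ u ≡ᶻ y [mod n ]) (sym same) (⟦⟧-≡ᶻ y))

  adjacent-sym : ∀ {u v} → CircAdj n S u v → CircAdj n S v u
  adjacent-sym (s , s∈S , forward⊎backward) = s , s∈S , Sum.swap forward⊎backward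

  adjacent-+ : ∀ {s} → s ∈ S → ∀ x → CircAdj n S ⟦ x ⟧ ⟦ x ℤ.+ + s ⟧
  adjacent-+ {s} s∈S x =
    s , s∈S , inj₁ (≡ᶻ⇒[mod] (≡ᶻ-trans (≡ᶻ-+ (⟦⟧-≡ᶻ x) ≡ᶻ-refl)
                                        (≡ᶻ-sym (⟦⟧-≡ᶻ (x ℤ.+ + s)))))

  adjacent-- : ∀ {s} → s ∈ S → ∀ x → CircAdj n S ⟦ x ⟧ ⟦ x ℤ.- + s ⟧
  adjacent-- {s} s∈S x =
    adjacent-sym (subst (λ y → CircAdj n S ⟦ x ℤ.- + s ⟧ ⟦ y ⟧) (cancel x (+ s)) (adjacent-+ s∈S (x ℤ.- + s)))
    where
    cancel : ∀ x s → x ℤ.- s ℤ.+ s ≡ x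
    cancel = solve-∀

  adjacent-step : ∀ x σ → CircAdj n S ⟦ x ⟧ ⟦ x ℤ.+ step (+ a) (+ b) σ ⟧
  adjacent-step x a⁺ = adjacent-+ (here refl) x
  adjacent-step x a⁻ = adjacent-- (here refl) x
  adjacent-step x b⁺ = adjacent-+ (there (here refl)) x
  adjacent-step x b⁻ = adjacent-- (there (here refl)) x

  walk⇒Dist≤2 : ∀ x w → Dist≤2 n S ⟦ x ⟧ ⟦ x ℤ.+ displacement (+ a) (+ b) w ⟧
  walk⇒Dist≤2 x [ σ ] = inj₁ (adjacent-step x σ)
  walk⇒Dist≤2 x (σ ∙ τ) = inj₂ (⟦ y ⟧ , adjacent-step x σ ,
    subst (λ z → CircAdj n S ⟦ y ⟧ ⟦ z ⟧) (ℤ.+-assoc x (step (+ a) (+ b) σ) (step (+ a) (+ b) τ))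
          (adjacent-step y τ))
    where
    y = x ℤ.+ step (+ a) (+ b) σ

  adjacent⇒step : ∀ {u v} → CircAdj n S u v →
                  ∃ λ σ → + toℕ v ≡ᶻ + toℕ u ℤ.+ step (+ a) (+ b) σ [mod n ]
  adjacent⇒step (_ , here refl , inj₁ forward) = a⁺ , ≡ᶻ-sym ([mod]⇒≡ᶻ forward)
  adjacent⇒step (_ , there (here refl) , inj₁ forward) = b⁺ , ≡ᶻ-sym ([mod]⇒≡ᶻ forward)
  adjacent⇒step (_ , here refl , inj₂ backward) = a⁻ , ≡ᶻ-move {s = + a} ([mod]⇒≡ᶻ backward)
  adjacent⇒step (_ , there (here refl) , inj₂ backward) = b⁻ , ≡ᶻ-move {s = + b} ([mod]⇒≡ᶻ backward)

  Dist≤2⇒walk : ∀ {u v} → Dist≤2 n S u v →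
                ∃ λ w → + toℕ v ≡ᶻ + toℕ u ℤ.+ displacement (+ a) (+ b) w [mod n ]
  Dist≤2⇒walk (inj₁ adj) = let σ , v≡u+σ = adjacent⇒step adj in [ σ ] , v≡u+σ
  Dist≤2⇒walk {u} (inj₂ (_ , adj₁ , adj₂)) =
    let σ , m≡u+σ = adjacent⇒step adj₁ ; τ , v≡m+τ = adjacent⇒step adj₂ in
    σ ∙ τ , ≡ᶻ-trans v≡m+τ (≡ᶻ-trans (≡ᶻ-+ m≡u+σ (≡ᶻ-refl {x = step (+ a) (+ b) τ}))
                                     (≡ᶻ-reflexive (ℤ.+-assoc (+ toℕ u) (step (+ a) (+ b) σ) (step (+ a) (+ b) τ))))

  backtrack⇒≡ : ∀ {u v} w → + toℕ v ≡ᶻ + toℕ u ℤ.+ displacement (+ a) (+ b) w [mod n ] →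
                Backtracks w → u ≡ v
  backtrack⇒≡ {u} {v} w v≡u+d back =
    sym (Fin.toℕ-injective (≡ᶻ-unique (Fin.toℕ<n v) (Fin.toℕ<n u)
      (subst (λ x → + toℕ v ≡ᶻ x [mod n ]) u+d≡u v≡u+d)))
    where
    u+d≡u : + toℕ u ℤ.+ displacement (+ a) (+ b) w ≡ + toℕ u
    u+d≡u = trans (cong (ℤ._+_ (+ toℕ u)) (backtrack-displacement (+ a) (+ b) {w} back)) (ℤ.+-identityʳ _)

  module _ {K : ℕ} (colouring : TwoDistColoring n S K) where

    induced : ℤ → Fin K
    induced x = proj₁ colouring ⟦ x ⟧

    open Separation induced

    walk-separates : ∀ w → 0 < ∣ displacement (+ a) (+ b) w ∣ → ∣ displacement (+ a) (+ b) w ∣ < n →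
                     Separates (displacement (+ a) (+ b) w)
    walk-separates w 0<∣d∣ ∣d∣<n x same =
      proj₂ colouring ⟦ x ⟧ ⟦ x ℤ.+ d ⟧ distinct same (walk⇒Dist≤2 x w)
      where
      d = displacement (+ a) (+ b) w
      distinct : ⟦ x ⟧ ≢ ⟦ x ℤ.+ d ⟧
      distinct eq =
        ℕ.<⇒≢ 0<∣d∣ (sym (cong ∣_∣ (divisible-small (∣-shift (⟦⟧-exact {x} {x ℤ.+ d} eq)) ∣d∣<n)))

    induced-distance2 : 0 < a → a < b → b + b < n → Distance2 (+ a) (+ b)
    induced-distance2 0<a a<b 2b<n = record
      { sep-a   = walk-separates [ a⁺ ] 0<a (ℕ.<-trans a<b b<n)
      ; sep-b   = walk-separates [ b⁺ ] 0<b b<n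
      ; sep-2a  = walk-separates (a⁺ ∙ a⁺) (ℕ.<-≤-trans 0<a (ℕ.m≤m+n a a)) (ℕ.<-trans (ℕ.+-mono-< a<b a<b) 2b<n)
      ; sep-2b  = walk-separates (b⁺ ∙ b⁺) (ℕ.<-≤-trans 0<b (ℕ.m≤m+n b b)) 2b<n
      ; sep-a+b = walk-separates (a⁺ ∙ b⁺) (ℕ.<-≤-trans 0<a (ℕ.m≤m+n a b)) (ℕ.<-trans (ℕ.+-monoˡ-< b a<b) 2b<n)
      ; sep-a-b = walk-separates (a⁺ ∙ b⁻) (subst (0 <_) (sym ∣a-b∣) (ℕ.m<n⇒0<n∸m a<b))
                                            (subst (_< n) (sym ∣a-b∣) (ℕ.≤-<-trans (ℕ.m∸n≤m b a) b<n)) }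
      where
      0<b = ℕ.<-trans 0<a a<b
      b<n = ℕ.≤-<-trans (ℕ.m≤m+n b b) 2b<n
      ∣a-b∣ : ∣ + a ℤ.- + b ∣ ≡ b ∸ a
      ∣a-b∣ = trans (cong ∣_∣ (trans (ℤ.m-n≡m⊖n a b) (ℤ.⊖-≤ (ℕ.<⇒≤ a<b))))
                    (ℤ.∣-i∣≡∣i∣ (+ (b ∸ a)))

lift : ∀ {K} n p a b .{{_ : NonZero n}} .{{_ : NonZero p}} → p ℕ.∣ n → ShortCycleFree p (+ a) (+ b) →
       TwoDistColoring p (a ∷ b ∷ []) K → TwoDistColoring n (a ∷ b ∷ []) K
lift n p a b p∣n free (f , proper) = (λ u → f (reduce u)) , proper′
  where
  module Cₙ = Circulant n a b
  module Cₚ = Circulant p a b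
  reduce : Fin n → Fin p
  reduce u = Cₚ.⟦ + toℕ u ⟧
  proper′ : ∀ u v → u ≢ v → f (reduce u) ≡ f (reduce v) → ¬ Dist≤2 n Cₙ.S u v
  proper′ u v u≢v same dist with Cₙ.Dist≤2⇒walk dist
  ... | w , v≡u+d with reduce u Fin.≟ reduce v
  ...   | no u≢ᵖv = proper (reduce u) (reduce v) u≢ᵖv same (subst (Dist≤2 p Cₚ.S (reduce u))
                      (Cₚ.⟦⟧-cong (≡ᶻ-sym (≡ᶻ-weaken p∣n v≡u+d))) (Cₚ.walk⇒Dist≤2 (+ toℕ u) w))
  ...   | yes u≡ᵖv = u≢v (Cₙ.backtrack⇒≡ w v≡u+d (free w (∣-shift
                      (≡ᶻ-trans (Cₚ.⟦⟧-exact {+ toℕ u} {+ toℕ v} u≡ᵖv) (≡ᶻ-weaken p∣n v≡u+d)))))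

identity-colouring : ∀ n S → TwoDistColoring n S n
identity-colouring n S = (λ u → u) , λ u v u≢v same _ → u≢v same

-- Block colourings

%-shift-≢ : ∀ {m} .{{_ : NonZero m}} {x y c q} → 0 < c → c < m → x + c ≡ y + q * m → x % m ≢ y % m
%-shift-≢ {m} {x} {y} {c} {q} 0<c c<m x+c≡y+qm x%m≡y%m =
  ℕ.<⇒≱ c<m (ℕ.∣⇒≤ {{ℕ.>-nonZero 0<c}} (∣⇒∣ᵤ (∣-shift {d = + c} (≡ᶻ-trans x≡y y≡x+c))))
  where
  x≡y : + x ≡ᶻ + y [mod m ]
  x≡y = ≡ᶻ-trans (≡ᶻ-sym (≡ᶻ-%ℕ (+ x)))
                 (subst (λ r → + r ≡ᶻ + y [mod m ]) (sym x%m≡y%m) (≡ᶻ-%ℕ (+ y)))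
  y≡x+c : + y ≡ᶻ + x ℤ.+ + c [mod m ]
  y≡x+c = ≡ᶻ-sym ([mod]⇒≡ᶻ (q , inj₁ x+c≡y+qm))

≢-resp-≡ : ∀ {A : Set} {x x′ y y′ : A} → x ≡ x′ → y ≡ y′ → x′ ≢ y′ → x ≢ y
≢-resp-≡ refl refl x′≢y′ = x′≢y′

module Pattern (k : ℕ) where

  colour : ℕ → ℕ
  colour X with X ℕ.<? 5 * k
  ... | yes _ = X % 5
  ... | no _ = (X ∸ 5 * k) % 6

  colour-< : ∀ {X} → X < 5 * k → colour X ≡ X % 5
  colour-< {X} X<5k with X ℕ.<? 5 * k
  ... | yes _ = refl
  ... | no X≮5k = ⊥-elim (X≮5k X<5k)

  colour-≥ : ∀ {X} → ¬ X < 5 * k → colour X ≡ (X ∸ 5 * k) % 6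
  colour-≥ {X} X≮5k with X ℕ.<? 5 * k
  ... | yes X<5k = ⊥-elim (X≮5k X<5k)
  ... | no _ = refl

  colour<6 : ∀ X → colour X < 6
  colour<6 X with X ℕ.<? 5 * k
  ... | yes _ = ℕ.m<n⇒m<1+n (ℕ.m%n<n X 5)
  ... | no _ = ℕ.m%n<n (X ∸ 5 * k) 6

  colour-small : ∀ {Y} → Y < 5 → colour Y ≡ Y
  colour-small {Y} Y<5 with Y ℕ.<? 5 * k
  ... | yes _ = ℕ.m<n⇒m%n≡m Y<5
  ... | no Y≮5k = begin
    (Y ∸ 5 * k) % 6  ≡⟨ cong (λ z → (Y ∸ z) % 6) (5k≡0 k (ℕ.≤-<-trans (ℕ.≮⇒≥ Y≮5k) Y<5)) ⟩
    Y % 6            ≡⟨ ℕ.m<n⇒m%n≡m (ℕ.m<n⇒m<1+n Y<5) ⟩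
    Y                ∎
    where
    5k≡0 : ∀ k → 5 * k < 5 → 5 * k ≡ 0
    5k≡0 0 _ = refl
    5k≡0 (ℕ.suc k) 5k<5 = ⊥-elim (ℕ.<⇒≱ 5k<5 (ℕ.m≤m*n 5 (ℕ.suc k)))

  colour-shift : ∀ {X c} → 0 < c → c < 5 → colour X ≢ colour (X + c)
  colour-shift {X} {c} 0<c c<5 = compare (X ℕ.<? 5 * k) (X + c ℕ.<? 5 * k)
    where
    compare : Dec (X < 5 * k) → Dec (X + c < 5 * k) → colour X ≢ colour (X + c)
    compare (yes X<5k) (yes X+c<5k) =
      ≢-resp-≡ (colour-< X<5k) (colour-< X+c<5k) (%-shift-≢ {q = 0} 0<c c<5 (sym (ℕ.+-identityʳ (X + c))))
    compare (yes X<5k) (no X+c≮5k) =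
      ≢-resp-≡ (colour-< X<5k) (trans (colour-≥ X+c≮5k) Z%6≡Z%5)
               (%-shift-≢ {q = k} 0<c c<5 (trans X+c≡Z+5k (cong (_+_ Z) (ℕ.*-comm 5 k))))
      where
      Z = X + c ∸ 5 * k
      X+c≡Z+5k : X + c ≡ Z + 5 * k
      X+c≡Z+5k = sym (ℕ.m∸n+n≡m (ℕ.≮⇒≥ X+c≮5k))
      Z<5 : Z < 5
      Z<5 = ℕ.+-cancelʳ-< (5 * k) Z 5 (subst₂ _<_ X+c≡Z+5k (ℕ.+-comm (5 * k) 5) (ℕ.+-mono-< X<5k c<5))
      Z%6≡Z%5 : Z % 6 ≡ Z % 5
      Z%6≡Z%5 = trans (ℕ.m<n⇒m%n≡m (ℕ.m<n⇒m<1+n Z<5)) (sym (ℕ.m<n⇒m%n≡m Z<5))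
    compare (no X≮5k) (yes X+c<5k) = ⊥-elim (X≮5k (ℕ.≤-<-trans (ℕ.m≤m+n X c) X+c<5k))
    compare (no X≮5k) (no X+c≮5k) =
      ≢-resp-≡ (colour-≥ X≮5k) (colour-≥ X+c≮5k)
               (%-shift-≢ {q = 0} 0<c (ℕ.m<n⇒m<1+n c<5)
                          (trans (sym (ℕ.+-∸-comm c (ℕ.≮⇒≥ X≮5k))) (sym (ℕ.+-identityʳ _))))

  period : ℕ → ℕ
  period ℓ = 5 * k + 6 * ℓ

  colour-wrap : ∀ ℓ {X Y c} → X < period ℓ → 0 < c → c < 5 → X + c ≡ Y + period ℓ → colour X ≢ colour Y
  colour-wrap ℓ {X} {Y} {c} X<p 0<c c<5 wrap = ≢-resp-≡ refl (colour-small Y<5) (compare ℓ (X ℕ.<? 5 * k) wrap)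
    where
    Y<5 : Y < 5
    Y<5 = ℕ.<-trans (ℕ.+-cancelʳ-< (period ℓ) Y c
                      (subst₂ _<_ wrap (ℕ.+-comm (period ℓ) c) (ℕ.+-monoˡ-< c X<p))) c<5
    compare : ∀ ℓ → Dec (X < 5 * k) → X + c ≡ Y + period ℓ → colour X ≢ Y
    compare 0 (yes X<5k) wrap₀ =
      ≢-resp-≡ (colour-< X<5k) (sym (ℕ.m<n⇒m%n≡m Y<5))
               (%-shift-≢ {q = k} 0<c c<5 (trans wrap₀ (cong (_+_ Y) (trans (ℕ.+-identityʳ (5 * k)) (ℕ.*-comm 5 k)))))
    compare (ℕ.suc ℓ) (yes X<5k) wrapₛ = ⊥-elim (
      ℕ.<⇒≱ (ℕ.+-mono-< X<5k c<5) (subst (5 * k + 5 ≤_) (sym wrapₛ)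
        (ℕ.≤-trans (ℕ.+-monoʳ-≤ (5 * k) (ℕ.≤-trans (ℕ.n≤1+n 5) (ℕ.m≤m*n 6 (ℕ.suc ℓ))))
                   (ℕ.m≤n+m _ Y))))
    compare ℓ (no X≮5k) wrapℓ =
      ≢-resp-≡ (colour-≥ X≮5k) (sym (ℕ.m<n⇒m%n≡m (ℕ.m<n⇒m<1+n Y<5)))
               (%-shift-≢ {q = ℓ} 0<c (ℕ.m<n⇒m<1+n c<5) (begin
                 X ∸ 5 * k + c          ≡⟨ ℕ.+-∸-comm c (ℕ.≮⇒≥ X≮5k) ⟨
                 X + c ∸ 5 * k          ≡⟨ cong (_∸ 5 * k) wrapℓ ⟩
                 Y + period ℓ ∸ 5 * k    ≡⟨ cong (_∸ 5 * k) (reorder Y) ⟩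
                 Y + 6 * ℓ + 5 * k ∸ 5 * k ≡⟨ ℕ.m+n∸n≡m (Y + 6 * ℓ) (5 * k) ⟩
                 Y + 6 * ℓ             ≡⟨ cong (_+_ Y) (ℕ.*-comm 6 ℓ) ⟩
                 Y + ℓ * 6             ∎))
      where
      reorder : ∀ Y → Y + period ℓ ≡ Y + 6 * ℓ + 5 * k
      reorder Y = trans (cong (_+_ Y) (ℕ.+-comm (5 * k) (6 * ℓ))) (sym (ℕ.+-assoc Y (6 * ℓ) (5 * k)))

  colour-separates : ∀ ℓ → 5 ≤ period ℓ → ∀ {X Y c} → X < period ℓ → Y < period ℓ → 0 < c → c < 5 →
                     X + c ≡ Y [mod period ℓ ] → colour X ≢ colour Y
  colour-separates ℓ 5≤p {X} {Y} {c} X<p Y<p 0<c c<5 (q , X+c≡Y+qp⊎Y≡X+c+qp) = separate q X+c≡Y+qp⊎Y≡X+c+qp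
    where
    p = period ℓ
    separate : ∀ q → X + c ≡ Y + q * p ⊎ Y ≡ X + c + q * p → colour X ≢ colour Y
    separate 0 (inj₁ X+c≡Y+0) =
      ≢-resp-≡ refl (cong colour (trans (sym (ℕ.+-identityʳ Y)) (sym X+c≡Y+0))) (colour-shift 0<c c<5)
    separate 0 (inj₂ Y≡X+c+0) =
      ≢-resp-≡ refl (cong colour (trans Y≡X+c+0 (ℕ.+-identityʳ (X + c)))) (colour-shift 0<c c<5)
    separate 1 (inj₁ X+c≡Y+p+0) =
      colour-wrap ℓ X<p 0<c c<5 (trans X+c≡Y+p+0 (cong (_+_ Y) (ℕ.+-identityʳ p)))
    separate (ℕ.suc (ℕ.suc q)) (inj₁ X+c≡Y+qp) =
      ⊥-elim (ℕ.<⇒≱ (ℕ.<-≤-trans (ℕ.+-mono-< X<p c<5) (ℕ.+-monoʳ-≤ p 5≤p))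
      (subst (p + p ≤_) (sym X+c≡Y+qp) (ℕ.≤-trans (ℕ.+-monoʳ-≤ p (ℕ.m≤m+n p (q * p))) (ℕ.m≤n+m _ Y))))
    separate (ℕ.suc q) (inj₂ Y≡X+c+qp) = ⊥-elim (ℕ.<⇒≱ Y<p
      (subst (p ≤_) (sym Y≡X+c+qp) (ℕ.≤-trans (ℕ.m≤m+n p (q * p)) (ℕ.m≤n+m _ (X + c)))))


module Modulus1+t (t : ℕ) where

  t≡-1 : + t ≡ᶻ -[1+ 0 ] [mod ℕ.suc t ]
  t≡-1 = mod∣ (divides -[1+ 0 ] (wrap (+ t)))
    where
    wrap : ∀ T → -[1+ 0 ] ℤ.- T ≡ -[1+ 0 ] ℤ.* (+ 1 ℤ.+ T)
    wrap = solve-∀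

  ShortShift : ℤ → Set
  ShortShift d = 0 < ∣ d ∣ × ∣ d ∣ < 5

  short-walks : ∀ w → Backtracks w ⊎ ShortShift (displacement (+ 2) -[1+ 0 ] w)
  short-walks = from-yes (allWalks? λ w → backtracks? w ⊎-dec (0 ℕ.<? ∣ d w ∣ ×-dec ∣ d w ∣ ℕ.<? 5))
    where
    d = displacement (+ 2) -[1+ 0 ]

  reduce : ∀ w → displacement (+ 2) (+ t) w ≡ᶻ displacement (+ 2) -[1+ 0 ] w [mod ℕ.suc t ]
  reduce = displacement-cong ≡ᶻ-refl t≡-1

  shortCycleFree : 5 ≤ ℕ.suc t → ShortCycleFree (ℕ.suc t) (+ 2) (+ t)
  shortCycleFree 5≤p w p∣d with short-walks w
  ... | inj₁ back = back
  ... | inj₂ (0<∣d′∣ , ∣d′∣<5) =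
    ⊥-elim (ℕ.<⇒≢ 0<∣d′∣ (sym (cong ∣_∣
      (divisible-small (∣-resp-≡ᶻ (reduce w) p∣d) (ℕ.<-≤-trans ∣d′∣<5 5≤p)))))

  pattern-colouring : ∀ k ℓ → 5 * k + 6 * ℓ ≡ ℕ.suc t → 5 ≤ ℕ.suc t →
                      TwoDistColoring (ℕ.suc t) (2 ∷ t ∷ []) 6
  pattern-colouring k ℓ period≡ 5≤p = (λ u → fromℕ< (colour<6 (toℕ u))) , proper
    where
    open Pattern k
    open Circulant (ℕ.suc t) 2 t using (Dist≤2⇒walk; backtrack⇒≡)
    Separated : ℕ → Set
    Separated p = ∀ {X Y c} → X < p → Y < p → 0 < c → c < 5 → X + c ≡ Y [mod p ] → colour X ≢ colour Y
    separated : Separated (ℕ.suc t)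
    separated = subst Separated period≡ (colour-separates ℓ (subst (5 ≤_) (sym period≡) 5≤p))
    colour-injective : ∀ {X Y} → fromℕ< (colour<6 X) ≡ fromℕ< (colour<6 Y) → colour X ≡ colour Y
    colour-injective = Fin.fromℕ<-injective _ _ (colour<6 _) (colour<6 _)
    proper : ∀ u v → u ≢ v → fromℕ< (colour<6 (toℕ u)) ≡ fromℕ< (colour<6 (toℕ v)) →
             ¬ Dist≤2 (ℕ.suc t) (2 ∷ t ∷ []) u v
    proper u v u≢v same dist with Dist≤2⇒walk dist
    ... | w , v≡u+d with short-walks w
    ...   | inj₁ back = u≢v (backtrack⇒≡ w v≡u+d back)
    ...   | inj₂ (0<∣d′∣ , ∣d′∣<5) with ≡ᶻ⇒[mod]-signed (displacement (+ 2) -[1+ 0 ] w)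
                                       (≡ᶻ-trans v≡u+d (≡ᶻ-+ (≡ᶻ-refl {x = + toℕ u}) (reduce w)))
    ...     | inj₁ u+c≡v = separated (Fin.toℕ<n u) (Fin.toℕ<n v) 0<∣d′∣ ∣d′∣<5 u+c≡v (colour-injective same)
    ...     | inj₂ v+c≡u = separated (Fin.toℕ<n v) (Fin.toℕ<n u) 0<∣d′∣ ∣d′∣<5 v+c≡u (sym (colour-injective same))

χ₂≡-intro : ∀ {n S k} → TwoDistColoring n S k → (∀ {j} → TwoDistColoring n S j → k ≤ j) → χ₂≡ n S k
χ₂≡-intro colouring bound = colouring , λ j j<k col → ℕ.<⇒≱ j<k (bound col)

module LowerBounds (n t : ℕ) .{{_ : NonZero n}} (2<t : 2 < t) (2t<n : t + t < n) where
  open Circulant n 2 t using (S; induced; induced-distance2)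

  five≤colours : ∀ {K} → TwoDistColoring n S K → 5 ≤ K
  five≤colours col = Separation.five≤colours (induced col) (induced-distance2 col (s≤s z≤n) 2<t 2t<n)

  six≤colours : t % 5 ≡ 0 ⊎ t % 5 ≡ 2 ⊎ t % 5 ≡ 3 → ∀ {K} → TwoDistColoring n S K → 6 ≤ K
  six≤colours t%5∈ col = ℕ.≤∧≢⇒< (five≤colours col) λ { refl →
    FiveColours.no-distance2-colouring (induced col) t t%5∈ (induced-distance2 col (s≤s z≤n) 2<t 2t<n) }

  seven≤colours : t ≡ 3 → ∀ {K} → TwoDistColoring n S K → 7 ≤ K
  seven≤colours refl col = Separation.seven≤colours (induced col) (induced-distance2 col (s≤s z≤n) 2<t 2t<n)

residue-colouring : ∀ n p m t r .{{_ : NonZero n}} .{{_ : NonZero p}} → n ≡ p * m → t % p ≡ r →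
                    ShortCycleFree p (+ 2) (+ r) → TwoDistColoring n (2 ∷ t ∷ []) p
residue-colouring n p m t r n≡pm t%p≡r free =
  lift n p 2 t (ℕ.divides m (trans n≡pm (ℕ.*-comm p m)))
       (shortCycleFree-cong ≡ᶻ-refl (subst (λ r → + t ≡ᶻ + r [mod p ]) t%p≡r (≡ᶻ-sym (≡ᶻ-%ℕ (+ t)))) free)
       (identity-colouring p (2 ∷ t ∷ []))

t+t<n : ∀ {t n} → 3 < t → 4 * t ≤ n → t + t < n
t+t<n {t} 3<t 4t≤n = ℕ.<-≤-trans (subst (_< 4 * t) (cong (_+_ t) (ℕ.+-identityʳ t)) 2t<4t) 4t≤n
  where
  2t<4t : 2 * t < 4 * t
  2t<4t = ℕ.*-monoˡ-< t {{ℕ.>-nonZero (ℕ.<-trans (s≤s z≤n) 3<t)}} {2} {4} (s≤s (s≤s (s≤s z≤n)))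

%10⇒%5 : ∀ t {r} → t % 10 ≡ r → t % 5 ≡ r % 5
%10⇒%5 t t%10≡r = trans (sym (ℕ.m∣n⇒o%n%m≡o%m 5 10 t (ℕ.divides 2 refl))) (cong (_% 5) t%10≡r)

odd≢18 : ∀ r → 2 * r + 1 ≢ 18
odd≢18 r 2r+1≡18 = ℕ.1+n≢0 (begin
  1                ≡⟨ ℕ.[m+kn]%n≡m%n 1 r 2 ⟨
  (1 + r * 2) % 2  ≡⟨ cong (_% 2) (trans (ℕ.+-comm 1 (r * 2)) (trans (cong (_+ 1) (ℕ.*-comm r 2)) 2r+1≡18)) ⟩
  18 % 2           ∎)

ℓ≤a : ∀ {r t a ℓ} → t ≡ 2 * r + 1 → 15 ≤ t → t + 1 ≡ 5 * a + ℓ → ℓ < 5 → ℓ ≤ a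
ℓ≤a {r} {t} {a} {ℓ} t≡2r+1 15≤t t+1≡5a+ℓ ℓ<5 = ℕ.≮⇒≥ λ a<ℓ → excluded a<ℓ (a ℕ.≤? 2)
  where
  16≤5a+ℓ : 16 ≤ 5 * a + ℓ
  16≤5a+ℓ = subst (16 ≤_) t+1≡5a+ℓ (ℕ.+-monoˡ-≤ 1 15≤t)
  ℓ≤4 = ℕ.≤-pred ℓ<5
  excluded : a < ℓ → Dec (a ≤ 2) → ⊥
  excluded _ (yes a≤2) =
    ℕ.<⇒≱ (ℕ.≤-<-trans (ℕ.+-mono-≤ (ℕ.*-monoʳ-≤ 5 a≤2) ℓ≤4) (ℕ.<-trans (ℕ.n<1+n 14) (ℕ.n<1+n 15))) 16≤5a+ℓ
  excluded a<ℓ (no a≰2) = odd≢18 r (trans (sym t≡2r+1) (ℕ.+-cancelʳ-≡ 1 t 18 (begin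
    t + 1      ≡⟨ t+1≡5a+ℓ ⟩
    5 * a + ℓ  ≡⟨ cong₂ (λ a ℓ → 5 * a + ℓ) a≡3 ℓ≡4 ⟩
    19         ∎)))
    where
    3≤a = ℕ.≰⇒> a≰2
    a≡3 = ℕ.≤-antisym (ℕ.≤-pred (ℕ.<-≤-trans a<ℓ ℓ≤4)) 3≤a
    ℓ≡4 = ℕ.≤-antisym ℓ≤4 (ℕ.≤-<-trans 3≤a a<ℓ)

χ₂≡5 : ∀ t m → 3 < t → (t % 10 ≡ 1 ⊎ t % 10 ≡ 9) →
       ∀ n → n ≡ 5 * m → 4 * t ≤ n → χ₂≡ n (2 ∷ t ∷ []) 5
χ₂≡5 t m 3<t t%10∈ n n≡5m 4t≤n = χ₂≡-intro (upper t%10∈) (LowerBounds.five≤colours n t 2<t 2t<n)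
  where
  2<t = ℕ.<-trans (ℕ.n<1+n 2) 3<t
  2t<n = t+t<n 3<t 4t≤n
  instance
    _ = ℕ.>-nonZero (ℕ.≤-<-trans z≤n 2t<n)
  upper : t % 10 ≡ 1 ⊎ t % 10 ≡ 9 → TwoDistColoring n (2 ∷ t ∷ []) 5
  upper (inj₁ t%10≡1) =
    residue-colouring n 5 m t 1 n≡5m (%10⇒%5 t t%10≡1) (from-yes (shortCycleFree? 5 (+ 2) (+ 1)))
  upper (inj₂ t%10≡9) =
    residue-colouring n 5 m t 4 n≡5m (%10⇒%5 t t%10≡9) (from-yes (shortCycleFree? 5 (+ 2) (+ 4)))

χ₂≡6-by-residues : ∀ t m r → 3 < t → t % 5 ≡ 0 ⊎ t % 5 ≡ 2 ⊎ t % 5 ≡ 3 →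
                   t % 6 ≡ r → ShortCycleFree 6 (+ 2) (+ r) →
                   ∀ n → n ≡ 6 * m → 4 * t ≤ n → χ₂≡ n (2 ∷ t ∷ []) 6
χ₂≡6-by-residues t m r 3<t t%5∈ t%6≡r free n n≡6m 4t≤n =
  χ₂≡-intro (residue-colouring n 6 m t r n≡6m t%6≡r free) (LowerBounds.six≤colours n t 2<t 2t<n t%5∈)
  where
  2<t = ℕ.<-trans (ℕ.n<1+n 2) 3<t
  2t<n = t+t<n 3<t 4t≤n
  instance
    _ = ℕ.>-nonZero (ℕ.≤-<-trans z≤n 2t<n)

χ₂≡6-sporadic : ∀ t m → 3 < t → (t ≡ 5 ⊎ t ≡ 7 ⊎ t ≡ 13) →
                ∀ n → n ≡ 6 * m → 4 * t ≤ n → χ₂≡ n (2 ∷ t ∷ []) 6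
χ₂≡6-sporadic .5 m 3<t (inj₁ refl) =
  χ₂≡6-by-residues 5 m 5 3<t (inj₁ refl) refl (from-yes (shortCycleFree? 6 (+ 2) (+ 5)))
χ₂≡6-sporadic .7 m 3<t (inj₂ (inj₁ refl)) =
  χ₂≡6-by-residues 7 m 1 3<t (inj₂ (inj₁ refl)) refl (from-yes (shortCycleFree? 6 (+ 2) (+ 1)))
χ₂≡6-sporadic .13 m 3<t (inj₂ (inj₂ refl)) =
  χ₂≡6-by-residues 13 m 1 3<t (inj₂ (inj₂ refl)) refl (from-yes (shortCycleFree? 6 (+ 2) (+ 1)))

χ₂≡6 : ∀ t m → (∃ λ r → t ≡ 2 * r + 1) → (t % 10 ≡ 3 ⊎ t % 10 ≡ 5 ⊎ t % 10 ≡ 7) → 15 ≤ t →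
       ∀ a ℓ → t + 1 ≡ 5 * a + ℓ → ℓ < 5 →
       ∀ n → n ≡ (5 * (a ∸ ℓ) + 6 * ℓ) * m → 4 * t ≤ n → χ₂≡ n (2 ∷ t ∷ []) 6
χ₂≡6 t m (r , t≡2r+1) t%10∈ 15≤t a ℓ t+1≡5a+ℓ ℓ<5 n n≡sm 4t≤n =
  χ₂≡-intro (lift n (ℕ.suc t) 2 t 1+t∣n (Modulus1+t.shortCycleFree t 5≤1+t)
                 (Modulus1+t.pattern-colouring t (a ∸ ℓ) ℓ s≡1+t 5≤1+t))
            (LowerBounds.six≤colours n t 2<t 2t<n (residue t%10∈))
  where
  3<t = ℕ.<-≤-trans (ℕ.m≤m+n 4 11) 15≤t
  2<t = ℕ.<-trans (ℕ.n<1+n 2) 3<t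
  5≤1+t = ℕ.≤-trans (ℕ.m≤m+n 5 11) (s≤s 15≤t)
  2t<n = t+t<n 3<t 4t≤n
  instance
    _ = ℕ.>-nonZero (ℕ.≤-<-trans z≤n 2t<n)
  s≡1+t : 5 * (a ∸ ℓ) + 6 * ℓ ≡ ℕ.suc t
  s≡1+t = begin
    5 * (a ∸ ℓ) + 6 * ℓ    ≡⟨ regroup (a ∸ ℓ) ℓ ⟩
    5 * (a ∸ ℓ + ℓ) + ℓ    ≡⟨ cong (λ x → 5 * x + ℓ) (ℕ.m∸n+n≡m ℓ≤a′) ⟩
    5 * a + ℓ              ≡⟨ t+1≡5a+ℓ ⟨
    t + 1                  ≡⟨ ℕ.+-comm t 1 ⟩
    ℕ.suc t                ∎
    where
    ℓ≤a′ = ℓ≤a {r} t≡2r+1 15≤t t+1≡5a+ℓ ℓ<5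
    regroup : ∀ x y → 5 * x + 6 * y ≡ 5 * (x + y) + y
    regroup = solve-∀ᴺ
  1+t∣n : ℕ.suc t ℕ.∣ n
  1+t∣n = ℕ.divides m (trans n≡sm (trans (cong (_* m) s≡1+t) (ℕ.*-comm (ℕ.suc t) m)))
  residue : t % 10 ≡ 3 ⊎ t % 10 ≡ 5 ⊎ t % 10 ≡ 7 → t % 5 ≡ 0 ⊎ t % 5 ≡ 2 ⊎ t % 5 ≡ 3
  residue (inj₁ t%10≡3) = inj₂ (inj₂ (%10⇒%5 t t%10≡3))
  residue (inj₂ (inj₁ t%10≡5)) = inj₁ (%10⇒%5 t t%10≡5)
  residue (inj₂ (inj₂ t%10≡7)) = inj₂ (inj₁ (%10⇒%5 t t%10≡7))

χ₂≡7 : ∀ m n → 1 ≤ m → n ≡ 7 * m → χ₂≡ n (2 ∷ 3 ∷ []) 7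
χ₂≡7 m n 1≤m n≡7m =
  χ₂≡-intro (residue-colouring n 7 m 3 3 n≡7m refl (from-yes (shortCycleFree? 7 (+ 2) (+ 3))))
            (LowerBounds.seven≤colours n 3 ℕ.≤-refl 6<n refl)
  where
  6<n : 6 < n
  6<n = subst (6 <_) (sym n≡7m) (ℕ.m≤m*n 7 m {{ℕ.>-nonZero 1≤m}})
  instance
    _ = ℕ.>-nonZero (ℕ.≤-<-trans z≤n 6<n)

corollary16 : (∀ (t m : ℕ) → (∃ λ r → t ≡ 2 * r + 1) → 3 < t → 1 ≤ m →
    ((t % 10 ≡ 1 ⊎ t % 10 ≡ 9) → ∀ n → n ≡ 5 * m → 4 * t ≤ n → χ₂≡ n (2 ∷ t ∷ []) 5)
    × ((t ≡ 5 ⊎ t ≡ 7 ⊎ t ≡ 13) → ∀ n → n ≡ 6 * m → 4 * t ≤ n → χ₂≡ n (2 ∷ t ∷ []) 6)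
    × ((t % 10 ≡ 3 ⊎ t % 10 ≡ 5 ⊎ t % 10 ≡ 7) → 15 ≤ t →
    ∀ a ℓ → t + 1 ≡ 5 * a + ℓ → ℓ < 5 →
    ∀ n → n ≡ (5 * (a ∸ ℓ) + 6 * ℓ) * m → 4 * t ≤ n → χ₂≡ n (2 ∷ t ∷ []) 6))
    × (∀ (m n : ℕ) → 1 ≤ m → n ≡ 7 * m → χ₂≡ n (2 ∷ 3 ∷ []) 7)
corollary16 =
  (λ t m odd 3<t _ → χ₂≡5 t m 3<t , χ₂≡6-sporadic t m 3<t , χ₂≡6 t m odd) ,
  χ₂≡7
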